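{- Let $q$ be a positive integer and $S\subseteq[q]^2$ nonempty, with $V_x(S)\le|S|^{1.5}$ and $V_y(S)\le|S|^{1.5}$. Pick $S_x,S_y\subseteq[q]$ independently and uniformly at random among subsets of given sizes $|S_x|,|S_y|\ge q/\sqrt{|S|}$. Then $$\Pr\big[|(S_x\times S_y)\cap S|>0\big]\ge 1/4.$$
   Context: For $S\subseteq[q]^2$, $V_x(S)=\sum_{i\in[q]}|\{j\in[q]:(i,j)\in S\}|^2$ and $V_y(S)=\sum_{j\in[q]}|\{i\in[q]:(i,j)\in S\}|^2$. -}

module Defs where

open import Data.Bool using (Bool; true; false; _∧_; _∨_; if_then_else_)
open import Data.Nat using (ℕ; zero; suc; _+_; _*_)
open import Data.Fin using (Fin)
open import Data.Fin.Subset using (Subset; outside; inside; ∣_∣)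
open import Data.List using (List; []; _∷_; _++_; map; allFin; length; filter; concatMap)
open import Data.Nat.ListAction using (sum)
open import Data.Bool.ListAction using (any)
open import Data.Vec using (lookup; []; _∷_)
open import Data.Product using (_×_; _,_)
open import Relation.Nullary.Decidable using (does)
open import Data.Nat.Properties using (_≟_)
open import Data.Bool.Properties using () renaming (_≟_ to _≟B_)

Subset² : ℕ → Set
Subset² q = Fin q → Fin q → Bool

count : {n : ℕ} → (Fin n → Bool) → ℕ
count {n} P = sum (map (λ i → if P i then 1 else 0) (allFin n))

card² : {q : ℕ} → Subset² q → ℕ
card² {q} S = sum (map (λ i → count (S i)) (allFin q))

Vx : {q : ℕ} → Subset² q → ℕ
Vx {q} S = sum (map (λ i → count (λ j → S i j) * count (λ j → S i j)) (allFin q))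

Vy : {q : ℕ} → Subset² q → ℕ
Vy {q} S = sum (map (λ j → count (λ i → S i j) * count (λ i → S i j)) (allFin q))

allSubsets : (n : ℕ) → List (Subset n)
allSubsets zero = [] ∷ []
allSubsets (suc n) = map (outside ∷_) (allSubsets n) ++ map (inside ∷_) (allSubsets n)

subsetsOfSize : (n k : ℕ) → List (Subset n)
subsetsOfSize n k = filter (λ p → ∣ p ∣ ≟ k) (allSubsets n)

-- sample space: pairs (S_x, S_y) with |S_x| = a, |S_y| = b (uniform distribution)
samplePairs : (q a b : ℕ) → List (Subset q × Subset q)
samplePairs q a b = concatMap (λ X → map (λ Y → (X , Y)) (subsetsOfSize q b)) (subsetsOfSize q a)

meets : {q : ℕ} → Subset² q → Subset q × Subset q → Bool
meets {q} S (X , Y) = any (λ i → any (λ j → lookup X i ∧ lookup Y j ∧ S i j) (allFin q)) (allFin q)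

goodPairs : {q : ℕ} → Subset² q → (a b : ℕ) → ℕ
goodPairs {q} S a b = length (filter (λ XY → meets S XY ≟B true) (samplePairs q a b))

-- Second moment method for Z = |(S_x × S_y) ∩ S| over the N = C(q,a) C(q,b) samples.
-- Cauchy–Schwarz on the samples with Z > 0 gives (∑ Z)² ≤ #{Z > 0} · ∑ Z², so it suffices
-- that N · ∑ Z² ≤ 4 (∑ Z)². With A = C(q,a) and A₁ = C(q-1,a-1), so that a A = q A₁, every
-- point of [q] lies in A₁ samples and ∑ Z = |S| A₁ B₁. Expanding Z² over pairs of cells of S,
-- two distinct points lie together in at most A₁²/A samples (log-concavity of the binomial
-- coefficients), so N · ∑ Z² is at most a sum of four terms weighted by |S|, V_x, V_y and |S|²,
-- and the hypotheses on V_x, V_y, |S_x| and |S_y| bound each of them by (|S| A₁ B₁)².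
module Submission where

open import Data.Bool using (Bool; true; false; _∧_; if_then_else_)
open import Data.Bool.ListAction using (any)
open import Data.Bool.Properties using (¬-not) renaming (_≟_ to _≟ᴮ_)
open import Data.Fin using (Fin; zero; suc)
open import Data.Fin.Properties using () renaming (_≟_ to _≟ᶠ_)
open import Data.Fin.Subset using (Subset; outside; inside; ∣_∣)
open import Data.List using (List; []; _∷_; _++_; map; length; filter; concatMap; allFin)
open import Data.List.Properties using (map-tabulate)
open import Data.Nat using (ℕ; zero; suc; _+_; _*_; _^_; _≤_; _<_; z≤n; s≤s; NonZero; >-nonZero)
open import Data.Nat.Combinatorics using (_C_; nCk≡nC[n∸k]; nCn≡1; nCk+nC[k+1]≡[n+1]C[k+1]; k>n⇒nCk≡0)
open import Data.Nat.ListAction using (sum)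
open import Data.Nat.Properties
open import Algebra.Properties.CommutativeSemigroup +-commutativeSemigroup
  using () renaming (interchange to +-interchange)
open import Algebra.Properties.CommutativeSemigroup *-commutativeSemigroup
  using (x∙yz≈y∙xz; x∙yz≈y∙zx; x∙yz≈yx∙z; xy∙z≈x∙zy) renaming (interchange to *-interchange)
open import Data.Nat.Tactic.RingSolver using (solve-∀)
open import Data.Product using (_×_; _,_; proj₁; proj₂)
open import Data.Sum using ([_,_]′; inj₁; inj₂)
open import Data.Vec using (lookup; _∷_)
open import Defs
open import Function using (_∘_; id)
open import Level using (Level)
open import Relation.Binary.PropositionalEquality
open import Relation.Nullary using (¬_; yes; no; contradiction)
open import Relation.Nullary.Decidable using (does)
open import Relation.Unary using (Pred; Decidable)

𝟙 : Bool → ℕ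
𝟙 b = if b then 1 else 0

𝟙*m≤m : ∀ b m → 𝟙 b * m ≤ m
𝟙*m≤m true  m = ≤-reflexive (+-identityʳ m)
𝟙*m≤m false m = z≤n

𝟙*𝟙 : ∀ b → 𝟙 b * 𝟙 b ≡ 𝟙 b
𝟙*𝟙 true  = refl
𝟙*𝟙 false = refl

𝟙-∧-≡0 : ∀ a b c → a ∧ b ∧ c ≡ false → 𝟙 a * 𝟙 b * 𝟙 c ≡ 0
𝟙-∧-≡0 true  true  false _ = refl
𝟙-∧-≡0 true  false c     _ = refl
𝟙-∧-≡0 false b     c     _ = refl

∑ : {A : Set} → List A → (A → ℕ) → ℕ
∑ xs f = sum (map f xs)

syntax ∑ xs (λ x → e) = ∑[ x ∈ xs ] e

module _ {A : Set} where

  ∑-cong : (xs : List A) {f g : A → ℕ} → (∀ x → f x ≡ g x) → ∑ xs f ≡ ∑ xs g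
  ∑-cong []       f≗g = refl
  ∑-cong (x ∷ xs) f≗g = cong₂ _+_ (f≗g x) (∑-cong xs f≗g)

  ∑-mono-≤ : (xs : List A) {f g : A → ℕ} → (∀ x → f x ≤ g x) → ∑ xs f ≤ ∑ xs g
  ∑-mono-≤ []       f≤g = z≤n
  ∑-mono-≤ (x ∷ xs) f≤g = +-mono-≤ (f≤g x) (∑-mono-≤ xs f≤g)

  ∑-zero : (xs : List A) {f : A → ℕ} → (∀ x → f x ≡ 0) → ∑ xs f ≡ 0
  ∑-zero []       f≡0 = refl
  ∑-zero (x ∷ xs) f≡0 = cong₂ _+_ (f≡0 x) (∑-zero xs f≡0)

  ∑-const : (xs : List A) (c : ℕ) → ∑[ x ∈ xs ] c ≡ length xs * c
  ∑-const []       c = refl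
  ∑-const (x ∷ xs) c = cong (c +_) (∑-const xs c)

  ∑-distrib-+ : (xs : List A) (f g : A → ℕ) → ∑[ x ∈ xs ] (f x + g x) ≡ ∑ xs f + ∑ xs g
  ∑-distrib-+ []       f g = refl
  ∑-distrib-+ (x ∷ xs) f g =
    trans (cong (f x + g x +_) (∑-distrib-+ xs f g)) (+-interchange (f x) (g x) _ _)

  ∑-distribˡ-* : (xs : List A) (c : ℕ) (f : A → ℕ) → ∑[ x ∈ xs ] (c * f x) ≡ c * ∑ xs f
  ∑-distribˡ-* []       c f = sym (*-zeroʳ c)
  ∑-distribˡ-* (x ∷ xs) c f = trans (cong (c * f x +_) (∑-distribˡ-* xs c f)) (sym (*-distribˡ-+ c (f x) _))

  ∑-distribʳ-* : (xs : List A) (c : ℕ) (f : A → ℕ) → ∑[ x ∈ xs ] (f x * c) ≡ ∑ xs f * c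
  ∑-distribʳ-* xs c f = begin
    ∑[ x ∈ xs ] (f x * c) ≡⟨ ∑-cong xs (λ x → *-comm (f x) c) ⟩
    ∑[ x ∈ xs ] (c * f x) ≡⟨ ∑-distribˡ-* xs c f ⟩
    c * ∑ xs f            ≡⟨ *-comm c _ ⟩
    ∑ xs f * c            ∎
    where open ≡-Reasoning

  ∑-lincomb : (xs : List A) (a b c d : ℕ) (f g h k : A → ℕ) →
              ∑[ x ∈ xs ] (a * f x + b * g x + c * h x + d * k x) ≡ a * ∑ xs f + b * ∑ xs g + c * ∑ xs h + d * ∑ xs k
  ∑-lincomb xs a b c d f g h k = begin
    ∑[ x ∈ xs ] (a * f x + b * g x + c * h x + d * k x)                         ≡⟨ ∑-distrib-+ xs _ _ ⟩
    ∑[ x ∈ xs ] (a * f x + b * g x + c * h x) + ∑[ x ∈ xs ] (d * k x)            ≡⟨ cong (_+ _) (∑-distrib-+ xs _ _) ⟩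
    ∑[ x ∈ xs ] (a * f x + b * g x) + ∑[ x ∈ xs ] (c * h x) + ∑[ x ∈ xs ] (d * k x)
      ≡⟨ cong (λ t → t + _ + _) (∑-distrib-+ xs _ _) ⟩
    ∑[ x ∈ xs ] (a * f x) + ∑[ x ∈ xs ] (b * g x) + ∑[ x ∈ xs ] (c * h x) + ∑[ x ∈ xs ] (d * k x)
      ≡⟨ cong₂ _+_ (cong₂ _+_ (cong₂ _+_ (∑-distribˡ-* xs a f) (∑-distribˡ-* xs b g)) (∑-distribˡ-* xs c h)) (∑-distribˡ-* xs d k) ⟩
    a * ∑ xs f + b * ∑ xs g + c * ∑ xs h + d * ∑ xs k                            ∎
    where open ≡-Reasoning

  ∑≡0-if-¬any : (xs : List A) (p : A → Bool) {f : A → ℕ} →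
                (∀ x → p x ≡ false → f x ≡ 0) → any p xs ≡ false → ∑ xs f ≡ 0
  ∑≡0-if-¬any []       p f≡0 _     = refl
  ∑≡0-if-¬any (x ∷ xs) p f≡0 ¬any with p x in px
  ... | false = cong₂ _+_ (f≡0 x px) (∑≡0-if-¬any xs p f≡0 ¬any)

  ∑-++ : (xs ys : List A) (f : A → ℕ) → ∑ (xs ++ ys) f ≡ ∑ xs f + ∑ ys f
  ∑-++ []       ys f = refl
  ∑-++ (x ∷ xs) ys f = trans (cong (f x +_) (∑-++ xs ys f)) (sym (+-assoc (f x) _ _))

  ∑-filter : {ℓ : Level} {P : Pred A ℓ} (P? : Decidable P) (xs : List A) (f : A → ℕ) →
             ∑ (filter P? xs) f ≡ ∑[ x ∈ xs ] (𝟙 (does (P? x)) * f x)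
  ∑-filter P? []       f = refl
  ∑-filter P? (x ∷ xs) f with does (P? x)
  ... | true  = cong₂ _+_ (sym (+-identityʳ (f x))) (∑-filter P? xs f)
  ... | false = ∑-filter P? xs f

module _ {A B : Set} where

  ∑-map : (g : A → B) (xs : List A) (f : B → ℕ) → ∑ (map g xs) f ≡ ∑[ x ∈ xs ] f (g x)
  ∑-map g []       f = refl
  ∑-map g (x ∷ xs) f = cong (f (g x) +_) (∑-map g xs f)

  ∑-concatMap : (g : A → List B) (xs : List A) (f : B → ℕ) →
                ∑ (concatMap g xs) f ≡ ∑[ x ∈ xs ] ∑ (g x) f
  ∑-concatMap g []       f = refl
  ∑-concatMap g (x ∷ xs) f = trans (∑-++ (g x) _ f) (cong (∑ (g x) f +_) (∑-concatMap g xs f))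

pairs : {A B : Set} → List A → List B → List (A × B)
pairs xs ys = concatMap (λ x → map (x ,_) ys) xs

module _ {A B : Set} where

  ∑-pairs : (xs : List A) (ys : List B) (f : A × B → ℕ) →
            ∑ (pairs xs ys) f ≡ ∑[ x ∈ xs ] ∑[ y ∈ ys ] f (x , y)
  ∑-pairs xs ys f = trans (∑-concatMap _ xs f) (∑-cong xs (λ x → ∑-map (x ,_) ys f))

  ∑-comm : (xs : List A) (ys : List B) (f : A → B → ℕ) →
           ∑[ x ∈ xs ] ∑[ y ∈ ys ] f x y ≡ ∑[ y ∈ ys ] ∑[ x ∈ xs ] f x y
  ∑-comm []       ys f = sym (∑-zero ys (λ _ → refl))
  ∑-comm (x ∷ xs) ys f =
    trans (cong (∑ ys (f x) +_) (∑-comm xs ys f)) (sym (∑-distrib-+ ys (f x) _))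

  ∑-*-∑ : (xs : List A) (ys : List B) (f : A → ℕ) (g : B → ℕ) →
          ∑ xs f * ∑ ys g ≡ ∑[ x ∈ xs ] ∑[ y ∈ ys ] (f x * g y)
  ∑-*-∑ xs ys f g = begin
    ∑ xs f * ∑ ys g                   ≡⟨ ∑-distribʳ-* xs (∑ ys g) f ⟨
    ∑[ x ∈ xs ] (f x * ∑ ys g)        ≡⟨ ∑-cong xs (λ x → ∑-distribˡ-* ys (f x) g) ⟨
    ∑[ x ∈ xs ] ∑[ y ∈ ys ] (f x * g y) ∎
    where open ≡-Reasoning

  ∑∑-separate : (xs : List A) (ys : List B) (f : A → ℕ) (g : B → ℕ) (c : ℕ) →
           ∑[ x ∈ xs ] ∑[ y ∈ ys ] (f x * g y * c) ≡ ∑ xs f * ∑ ys g * c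
  ∑∑-separate xs ys f g c = begin
    ∑[ x ∈ xs ] ∑[ y ∈ ys ] (f x * g y * c) ≡⟨ ∑-cong xs (λ x → ∑-distribʳ-* ys c _) ⟩
    ∑[ x ∈ xs ] (∑[ y ∈ ys ] (f x * g y) * c) ≡⟨ ∑-distribʳ-* xs c _ ⟩
    ∑[ x ∈ xs ] ∑[ y ∈ ys ] (f x * g y) * c   ≡⟨ cong (_* c) (∑-*-∑ xs ys f g) ⟨
    ∑ xs f * ∑ ys g * c                       ∎
    where open ≡-Reasoning

length-pairs : {A B : Set} (xs : List A) (ys : List B) → length (pairs xs ys) ≡ length xs * length ys
length-pairs xs ys = begin
  length (pairs xs ys)                  ≡⟨ *-identityʳ _ ⟨
  length (pairs xs ys) * 1              ≡⟨ ∑-const (pairs xs ys) 1 ⟨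
  ∑[ xy ∈ pairs xs ys ] 1               ≡⟨ ∑-pairs xs ys (λ _ → 1) ⟩
  ∑[ x ∈ xs ] ∑[ y ∈ ys ] 1             ≡⟨ ∑-cong xs (λ _ → trans (∑-const ys 1) (*-identityʳ _)) ⟩
  ∑[ x ∈ xs ] length ys                 ≡⟨ ∑-const xs (length ys) ⟩
  length xs * length ys                 ∎
  where open ≡-Reasoning

δ : ∀ {n} → Fin n → Fin n → ℕ
δ i j = 𝟙 (does (i ≟ᶠ j))

𝟏 : ∀ {n} → Fin n → Fin n → ℕ
𝟏 _ _ = 1

∑-allFin-suc : ∀ n (f : Fin (suc n) → ℕ) → ∑ (allFin (suc n)) f ≡ f zero + ∑[ i ∈ allFin n ] f (suc i)
∑-allFin-suc n f = cong (λ xs → f zero + sum xs)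
  (trans (map-tabulate suc f) (sym (map-tabulate id (f ∘ suc))))

∑-δ : ∀ {n} (i : Fin n) (g : Fin n → ℕ) → ∑[ k ∈ allFin n ] (δ i k * g k) ≡ g i
∑-δ {suc n} zero    g = begin
  ∑[ k ∈ allFin (suc n) ] (δ zero k * g k)  ≡⟨ ∑-allFin-suc n _ ⟩
  g zero + 0 + ∑[ k ∈ allFin n ] 0          ≡⟨ cong (g zero + 0 +_) (∑-zero (allFin n) (λ _ → refl)) ⟩
  g zero + 0 + 0                            ≡⟨ trans (+-identityʳ _) (+-identityʳ _) ⟩
  g zero                                    ∎
  where open ≡-Reasoning
∑-δ {suc n} (suc i) g = trans (∑-allFin-suc n (λ k → δ (suc i) k * g k)) (∑-δ i (g ∘ suc))

2*[m*n]≤m*m+n*n : ∀ m n → 2 * (m * n) ≤ m * m + n * n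
2*[m*n]≤m*m+n*n m n = [ ordered , swapped ]′ (≤-total m n)
  where
  ordered : ∀ {m n} → m ≤ n → 2 * (m * n) ≤ m * m + n * n
  ordered {m} m≤n with m≤n⇒∃[o]m+o≡n m≤n
  ... | d , refl = subst (2 * (m * (m + d)) ≤_) (expand m d) (m≤m+n _ (d * d))
    where
    expand : ∀ m d → 2 * (m * (m + d)) + d * d ≡ m * m + (m + d) * (m + d)
    expand = solve-∀
  swapped : n ≤ m → 2 * (m * n) ≤ m * m + n * n
  swapped n≤m = subst₂ _≤_ (cong (2 *_) (*-comm n m)) (+-comm (n * n) (m * m)) (ordered n≤m)

module _ {A : Set} where

  cauchy-schwarz : (xs : List A) (f : A → ℕ) → ∑ xs f * ∑ xs f ≤ length xs * ∑[ x ∈ xs ] (f x * f x)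
  cauchy-schwarz xs f = *-cancelˡ-≤ 2 (begin
    2 * (∑ xs f * ∑ xs f)                               ≡⟨ cong (2 *_) (∑-*-∑ xs xs f f) ⟩
    2 * (∑[ x ∈ xs ] ∑[ y ∈ xs ] (f x * f y))           ≡⟨ ∑-distribˡ-*₂ ⟨
    ∑[ x ∈ xs ] ∑[ y ∈ xs ] (2 * (f x * f y))           ≤⟨ ∑-mono-≤ xs (λ x → ∑-mono-≤ xs (λ y → 2*[m*n]≤m*m+n*n (f x) (f y))) ⟩
    ∑[ x ∈ xs ] ∑[ y ∈ xs ] (f x * f x + f y * f y)     ≡⟨ ∑-cong xs (λ x → ∑-distrib-+ xs _ _) ⟩
    ∑[ x ∈ xs ] (∑[ y ∈ xs ] (f x * f x) + Q)           ≡⟨ ∑-cong xs (λ x → cong (_+ Q) (∑-const xs _)) ⟩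
    ∑[ x ∈ xs ] (length xs * (f x * f x) + Q)           ≡⟨ ∑-distrib-+ xs _ _ ⟩
    ∑[ x ∈ xs ] (length xs * (f x * f x)) + ∑[ x ∈ xs ] Q ≡⟨ cong₂ _+_ (∑-distribˡ-* xs (length xs) (λ x → f x * f x)) (∑-const xs Q) ⟩
    length xs * Q + length xs * Q                        ≡⟨ cong (length xs * Q +_) (+-identityʳ _) ⟨
    2 * (length xs * Q)                                  ∎)
    where
    open ≤-Reasoning
    Q = ∑[ x ∈ xs ] (f x * f x)
    ∑-distribˡ-*₂ : ∑[ x ∈ xs ] ∑[ y ∈ xs ] (2 * (f x * f y)) ≡ 2 * (∑[ x ∈ xs ] ∑[ y ∈ xs ] (f x * f y))
    ∑-distribˡ-*₂ = trans (∑-cong xs (λ x → ∑-distribˡ-* xs 2 _)) (∑-distribˡ-* xs 2 _)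

  second-moment : {ℓ : Level} {P : Pred A ℓ} (P? : Decidable P) (xs : List A) (Z : A → ℕ) →
                  (∀ x → ¬ P x → Z x ≡ 0) →
                  ∑ xs Z * ∑ xs Z ≤ length (filter P? xs) * ∑[ x ∈ xs ] (Z x * Z x)
  second-moment P? xs Z Z≡0 = begin
    ∑ xs Z * ∑ xs Z                                   ≡⟨ cong (λ t → t * t) ∑-filter-Z ⟨
    ∑ ys Z * ∑ ys Z                                   ≤⟨ cauchy-schwarz ys Z ⟩
    length ys * ∑[ x ∈ ys ] (Z x * Z x)               ≤⟨ *-monoʳ-≤ (length ys) ∑-filter-Z² ⟩
    length ys * ∑[ x ∈ xs ] (Z x * Z x)               ∎
    where
    open ≤-Reasoning
    ys = filter P? xs
    restrict : ∀ x → 𝟙 (does (P? x)) * Z x ≡ Z x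
    restrict x with P? x
    ... | yes _  = +-identityʳ (Z x)
    ... | no  ¬p = sym (Z≡0 x ¬p)
    ∑-filter-Z : ∑ ys Z ≡ ∑ xs Z
    ∑-filter-Z = trans (∑-filter P? xs Z) (∑-cong xs restrict)
    ∑-filter-Z² : ∑[ x ∈ ys ] (Z x * Z x) ≤ ∑[ x ∈ xs ] (Z x * Z x)
    ∑-filter-Z² = ≤-trans (≤-reflexive (∑-filter P? xs _)) (∑-mono-≤ xs (λ x → 𝟙*m≤m (does (P? x)) _))

  second-moment-method : {ℓ : Level} {P : Pred A ℓ} (P? : Decidable P) (xs : List A) (Z : A → ℕ) (c : ℕ) →
    (∀ x → ¬ P x → Z x ≡ 0) → 0 < ∑ xs Z →
    ∑[ x ∈ xs ] (Z x * Z x) * length xs ≤ c * (∑ xs Z * ∑ xs Z) →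
    length xs ≤ c * length (filter P? xs)
  second-moment-method P? xs Z c Z≡0 0<E Q*N≤c*E² =
    *-cancelʳ-≤ N (c * G) (E * E) {{>-nonZero (*-mono-< 0<E 0<E)}} (begin
    N * (E * E)       ≤⟨ *-monoʳ-≤ N (second-moment P? xs Z Z≡0) ⟩
    N * (G * Q)       ≡⟨ x∙yz≈y∙zx N G Q ⟩
    G * (Q * N)       ≤⟨ *-monoʳ-≤ G Q*N≤c*E² ⟩
    G * (c * (E * E)) ≡⟨ x∙yz≈yx∙z G c (E * E) ⟩
    c * G * (E * E)   ∎)
    where
    open ≤-Reasoning
    N = length xs
    G = length (filter P? xs)
    E = ∑ xs Z
    Q = ∑[ x ∈ xs ] (Z x * Z x)

shift : (ℕ → ℕ) → ℕ → ℕ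
shift f zero    = 0
shift f (suc k) = f k

shift-cong : {f g : ℕ → ℕ} → (∀ k → f k ≡ g k) → ∀ k → shift f k ≡ shift g k
shift-cong f≗g zero    = refl
shift-cong f≗g (suc k) = f≗g k

nC0≡1 : ∀ n → n C 0 ≡ 1
nC0≡1 n = trans (nCk≡nC[n∸k] {0} {n} z≤n) (nCn≡1 n)

-- Pascal's rule; shift-pascal carries it from n C k to shift (n C_) k and shift (shift (n C_)) k,
-- the numbers of k-subsets of [n + 1] and [n + 2] containing one, resp. two, given points.
Pascal : (ℕ → ℕ → ℕ) → Set
Pascal f = ∀ n k → f (suc n) k ≡ f n k + shift (f n) k

C-pascal : Pascal _C_
C-pascal n zero    = trans (nC0≡1 (suc n)) (sym (trans (+-identityʳ (n C 0)) (nC0≡1 n)))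
C-pascal n (suc k) = sym (trans (+-comm (n C suc k) (n C k)) (nCk+nC[k+1]≡[n+1]C[k+1] n k))

shift-pascal : {f : ℕ → ℕ → ℕ} → Pascal f → Pascal (λ n → shift (f n))
shift-pascal pascal n zero    = refl
shift-pascal pascal n (suc k) = pascal n k

k≤n⇒0<nCk : ∀ {n k} → k ≤ n → 0 < n C k
k≤n⇒0<nCk {n}     {zero}  _         = ≤-reflexive (sym (nC0≡1 n))
k≤n⇒0<nCk {suc n} {suc k} (s≤s k≤n) =
  ≤-trans (k≤n⇒0<nCk k≤n) (≤-trans (m≤n+m (n C k) (n C (suc k))) (≤-reflexive (sym (C-pascal n (suc k)))))

k*[1+n]Ck≡[1+n]*nC[k-1] : ∀ n k → k * (suc n C k) ≡ suc n * shift (n C_) k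
k*[1+n]Ck≡[1+n]*nC[k-1] zero    zero          = refl
k*[1+n]Ck≡[1+n]*nC[k-1] zero    (suc zero)    = refl
k*[1+n]Ck≡[1+n]*nC[k-1] zero    (suc (suc k)) =
  trans (cong (suc (suc k) *_) (k>n⇒nCk≡0 {1} {suc (suc k)} (s≤s (s≤s z≤n))))
        (trans (*-zeroʳ (suc (suc k))) (sym (k>n⇒nCk≡0 {0} {suc k} (s≤s z≤n))))
k*[1+n]Ck≡[1+n]*nC[k-1] (suc m) zero          = sym (*-zeroʳ (suc (suc m)))
k*[1+n]Ck≡[1+n]*nC[k-1] (suc m) (suc k)       = begin
  suc k * (suc (suc m) C suc k)                        ≡⟨ cong (suc k *_) (C-pascal (suc m) (suc k)) ⟩
  suc k * (suc m C suc k + suc m C k)                  ≡⟨ rearrange₁ k (suc m C suc k) (suc m C k) ⟩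
  suc k * (suc m C suc k) + suc m C k + k * (suc m C k)
    ≡⟨ cong₂ (λ x y → x + suc m C k + y) (k*[1+n]Ck≡[1+n]*nC[k-1] m (suc k)) (k*[1+n]Ck≡[1+n]*nC[k-1] m k) ⟩
  suc m * (m C k) + suc m C k + suc m * shift (m C_) k ≡⟨ rearrange₂ m (m C k) (suc m C k) (shift (m C_) k) ⟩
  suc m C k + suc m * (m C k + shift (m C_) k)         ≡⟨ cong (λ x → suc m C k + suc m * x) (C-pascal m k) ⟨
  suc (suc m) * (suc m C k)                            ∎
  where
  open ≡-Reasoning
  rearrange₁ : ∀ k x y → suc k * (x + y) ≡ suc k * x + y + k * y
  rearrange₁ = solve-∀
  rearrange₂ : ∀ m x y z → suc m * x + y + suc m * z ≡ y + suc m * (x + z)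
  rearrange₂ = solve-∀

C-log-concave : ∀ n k → (suc (suc n) C suc (suc k)) * (n C k) ≤ (suc n C suc k) * (suc n C suc k)
C-log-concave n k with ≤-<-connex k n
... | inj₂ n<k = ≤-trans (≤-reflexive (trans (cong ((suc (suc n) C suc (suc k)) *_) (k>n⇒nCk≡0 n<k))
                                             (*-zeroʳ (suc (suc n) C suc (suc k)))))
                        z≤n
... | inj₁ k≤n = *-cancelˡ-≤ (suc (suc k) * suc n) (begin
  suc (suc k) * suc n * (z * y)      ≡⟨ *-interchange (suc (suc k)) (suc n) z y ⟩
  (suc (suc k) * z) * (suc n * y)   ≡⟨ cong₂ _*_ (k*[1+n]Ck≡[1+n]*nC[k-1] (suc n) (suc (suc k))) (sym (k*[1+n]Ck≡[1+n]*nC[k-1] n (suc k))) ⟩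
  (suc (suc n) * x) * (suc k * x)   ≡⟨ *-interchange (suc (suc n)) x (suc k) x ⟩
  suc (suc n) * suc k * (x * x)     ≤⟨ *-monoˡ-≤ (x * x) (factor-≤ k≤n) ⟩
  suc (suc k) * suc n * (x * x)     ∎)
  where
  open ≤-Reasoning
  x = suc n C suc k
  y = n C k
  z = suc (suc n) C suc (suc k)
  factor-≤ : ∀ {k n} → k ≤ n → suc (suc n) * suc k ≤ suc (suc k) * suc n
  factor-≤ {k} k≤n with m≤n⇒∃[o]m+o≡n k≤n
  ... | d , refl = subst₂ _≤_ (expand₁ k d) (expand₂ k d) (+-monoʳ-≤ (suc (suc k) * suc k) (*-monoʳ-≤ d (n≤1+n (suc k))))
    where
    expand₁ : ∀ k d → suc (suc k) * suc k + d * suc k ≡ suc (suc (k + d)) * suc k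
    expand₁ = solve-∀
    expand₂ : ∀ k d → suc (suc k) * suc k + d * suc (suc k) ≡ suc (suc k) * suc (k + d)
    expand₂ = solve-∀

∑-subsetsOfSize-suc : ∀ n k (f : Subset (suc n) → ℕ) →
  ∑ (subsetsOfSize (suc n) k) f ≡
  ∑[ p ∈ subsetsOfSize n k ] f (outside ∷ p) + shift (λ k′ → ∑[ p ∈ subsetsOfSize n k′ ] f (inside ∷ p)) k
∑-subsetsOfSize-suc n k f = begin
  ∑ (filter (sized k) (map (outside ∷_) all ++ map (inside ∷_) all)) f
    ≡⟨ ∑-filter (sized k) (map (outside ∷_) all ++ map (inside ∷_) all) f ⟩
  ∑ (map (outside ∷_) all ++ map (inside ∷_) all) (restrict k)
    ≡⟨ ∑-++ (map (outside ∷_) all) (map (inside ∷_) all) (restrict k) ⟩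
  ∑ (map (outside ∷_) all) (restrict k) + ∑ (map (inside ∷_) all) (restrict k)
    ≡⟨ cong₂ _+_ (∑-map (outside ∷_) all (restrict k)) (∑-map (inside ∷_) all (restrict k)) ⟩
  ∑[ p ∈ all ] restrict k (outside ∷ p) + ∑[ p ∈ all ] restrict k (inside ∷ p)
    ≡⟨ cong₂ _+_ (sym (∑-filter (sized k) all (λ p → f (outside ∷ p)))) (insides k) ⟩
  ∑[ p ∈ subsetsOfSize n k ] f (outside ∷ p) + shift (λ k′ → ∑[ p ∈ subsetsOfSize n k′ ] f (inside ∷ p)) k ∎
  where
  open ≡-Reasoning
  all = allSubsets n
  sized : ∀ {m} k → Decidable {A = Subset m} (λ p → ∣ p ∣ ≡ k)
  sized k p = ∣ p ∣ ≟ k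
  restrict : ℕ → Subset (suc n) → ℕ
  restrict k p = 𝟙 (does (sized k p)) * f p
  insides : ∀ k → ∑[ p ∈ all ] restrict k (inside ∷ p) ≡ shift (λ k′ → ∑[ p ∈ subsetsOfSize n k′ ] f (inside ∷ p)) k
  insides zero    = ∑-zero all (λ _ → refl)
  insides (suc k) = sym (∑-filter (sized k) all (λ p → f (inside ∷ p)))

#subsetsOfSize : ∀ n k → ∑[ p ∈ subsetsOfSize n k ] 1 ≡ n C k
#subsetsOfSize zero    zero    = refl
#subsetsOfSize zero    (suc k) = sym (k>n⇒nCk≡0 {0} {suc k} (s≤s z≤n))
#subsetsOfSize (suc n) k       = begin
  ∑[ p ∈ subsetsOfSize (suc n) k ] 1                                    ≡⟨ ∑-subsetsOfSize-suc n k (λ _ → 1) ⟩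
  ∑[ p ∈ subsetsOfSize n k ] 1 + shift (λ k′ → ∑[ p ∈ subsetsOfSize n k′ ] 1) k
    ≡⟨ cong₂ _+_ (#subsetsOfSize n k) (shift-cong (#subsetsOfSize n) k) ⟩
  n C k + shift (n C_) k                                                 ≡⟨ C-pascal n k ⟨
  suc n C k                                                              ∎
  where open ≡-Reasoning

length-subsetsOfSize : ∀ n k → length (subsetsOfSize n k) ≡ n C k
length-subsetsOfSize n k =
  trans (sym (*-identityʳ _)) (trans (sym (∑-const (subsetsOfSize n k) 1)) (#subsetsOfSize n k))

#subsetsOfSize-∋ : ∀ n k (i : Fin (suc n)) → ∑[ p ∈ subsetsOfSize (suc n) k ] 𝟙 (lookup p i) ≡ shift (n C_) k
#subsetsOfSize-∋ n       k zero    = begin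
  ∑[ p ∈ subsetsOfSize (suc n) k ] 𝟙 (lookup p zero)                         ≡⟨ ∑-subsetsOfSize-suc n k _ ⟩
  ∑[ p ∈ subsetsOfSize n k ] 0 + shift (λ k′ → ∑[ p ∈ subsetsOfSize n k′ ] 1) k
    ≡⟨ cong₂ _+_ (∑-zero (subsetsOfSize n k) (λ _ → refl)) (shift-cong (#subsetsOfSize n) k) ⟩
  shift (n C_) k                                                               ∎
  where open ≡-Reasoning
#subsetsOfSize-∋ (suc n) k (suc i) = begin
  ∑[ p ∈ subsetsOfSize (suc (suc n)) k ] 𝟙 (lookup p (suc i))                 ≡⟨ ∑-subsetsOfSize-suc (suc n) k _ ⟩
  ∑[ p ∈ subsetsOfSize (suc n) k ] 𝟙 (lookup p i)
    + shift (λ k′ → ∑[ p ∈ subsetsOfSize (suc n) k′ ] 𝟙 (lookup p i)) k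
    ≡⟨ cong₂ _+_ (#subsetsOfSize-∋ n k i) (shift-cong (λ k′ → #subsetsOfSize-∋ n k′ i) k) ⟩
  shift (n C_) k + shift (shift (n C_)) k                                      ≡⟨ shift-pascal C-pascal n k ⟨
  shift (suc n C_) k                                                           ∎
  where open ≡-Reasoning

#subsetsOfSize-∋∋ : ∀ n k {i j : Fin (suc (suc n))} → i ≢ j →
  ∑[ p ∈ subsetsOfSize (suc (suc n)) k ] (𝟙 (lookup p i) * 𝟙 (lookup p j)) ≡ shift (shift (n C_)) k
#subsetsOfSize-∋∋ n       k {zero}  {zero}  i≢j = contradiction refl i≢j
#subsetsOfSize-∋∋ n       k {zero}  {suc j} _   = begin
  ∑[ p ∈ subsetsOfSize (suc (suc n)) k ] (𝟙 (lookup p zero) * 𝟙 (lookup p (suc j))) ≡⟨ ∑-subsetsOfSize-suc (suc n) k _ ⟩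
  ∑[ p ∈ subsetsOfSize (suc n) k ] 0
    + shift (λ k′ → ∑[ p ∈ subsetsOfSize (suc n) k′ ] (𝟙 (lookup p j) + 0)) k
    ≡⟨ cong₂ _+_ (∑-zero (subsetsOfSize (suc n) k) (λ _ → refl)) (shift-cong containing-j k) ⟩
  shift (shift (n C_)) k                                                              ∎
  where
  open ≡-Reasoning
  containing-j : ∀ k′ → ∑[ p ∈ subsetsOfSize (suc n) k′ ] (𝟙 (lookup p j) + 0) ≡ shift (n C_) k′
  containing-j k′ = trans (∑-cong (subsetsOfSize (suc n) k′) (λ p → +-identityʳ _)) (#subsetsOfSize-∋ n k′ j)
#subsetsOfSize-∋∋ n       k {suc i} {zero}  _   =
  trans (∑-cong (subsetsOfSize (suc (suc n)) k) (λ p → *-comm (𝟙 (lookup p (suc i))) _))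
        (#subsetsOfSize-∋∋ n k {zero} {suc i} λ ())
#subsetsOfSize-∋∋ zero    k {suc zero} {suc zero} i≢j = contradiction refl i≢j
#subsetsOfSize-∋∋ (suc n) k {suc i} {suc j} i≢j = begin
  ∑[ p ∈ subsetsOfSize (suc (suc (suc n))) k ] (𝟙 (lookup p (suc i)) * 𝟙 (lookup p (suc j)))
    ≡⟨ ∑-subsetsOfSize-suc (suc (suc n)) k _ ⟩
  ∑[ p ∈ subsetsOfSize (suc (suc n)) k ] (𝟙 (lookup p i) * 𝟙 (lookup p j))
    + shift (λ k′ → ∑[ p ∈ subsetsOfSize (suc (suc n)) k′ ] (𝟙 (lookup p i) * 𝟙 (lookup p j))) k
    ≡⟨ cong₂ _+_ (#subsetsOfSize-∋∋ n k i′≢j′) (shift-cong (λ k′ → #subsetsOfSize-∋∋ n k′ i′≢j′) k) ⟩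
  shift (shift (n C_)) k + shift (shift (shift (n C_))) k                    ≡⟨ shift-pascal (shift-pascal C-pascal) n k ⟨
  shift (shift (suc n C_)) k                                                  ∎
  where
  open ≡-Reasoning
  i′≢j′ : i ≢ j
  i′≢j′ = i≢j ∘ cong suc

coverage : ∀ {n} → List (Subset n) → Fin n → Fin n → ℕ
coverage L i j = ∑[ p ∈ L ] (𝟙 (lookup p i) * 𝟙 (lookup p j))

coverage-subsetsOfSize-≢-≤ : ∀ n k {i j : Fin (suc n)} → i ≢ j →
  coverage (subsetsOfSize (suc n) k) i j * (suc n C k) ≤ shift (n C_) k * shift (n C_) k
coverage-subsetsOfSize-≢-≤ zero    k {zero} {zero} i≢j = contradiction refl i≢j
coverage-subsetsOfSize-≢-≤ (suc m) k i≢j rewrite #subsetsOfSize-∋∋ m k i≢j = log-concave k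
  where
  log-concave : ∀ k → shift (shift (m C_)) k * (suc (suc m) C k) ≤ shift (suc m C_) k * shift (suc m C_) k
  log-concave zero          = z≤n
  log-concave (suc zero)    = z≤n
  log-concave (suc (suc k)) = ≤-trans (≤-reflexive (*-comm (m C k) _)) (C-log-concave m k)

coverage-subsetsOfSize-≤ : ∀ n k (i j : Fin (suc n)) →
  coverage (subsetsOfSize (suc n) k) i j * (suc n C k)
    ≤ δ i j * ((suc n C k) * shift (n C_) k) + shift (n C_) k * shift (n C_) k
coverage-subsetsOfSize-≤ n k i j with i ≟ᶠ j
... | no  i≢j  = coverage-subsetsOfSize-≢-≤ n k i≢j
... | yes refl = begin
  coverage (subsetsOfSize (suc n) k) i i * (suc n C k)               ≡⟨ cong (_* (suc n C k)) diagonal ⟩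
  shift (n C_) k * (suc n C k)                                        ≡⟨ *-comm (shift (n C_) k) _ ⟩
  (suc n C k) * shift (n C_) k                                        ≡⟨ +-identityʳ _ ⟨
  (suc n C k) * shift (n C_) k + 0                                    ≤⟨ m≤m+n _ _ ⟩
  (suc n C k) * shift (n C_) k + 0 + shift (n C_) k * shift (n C_) k ∎
  where
  open ≤-Reasoning
  diagonal : coverage (subsetsOfSize (suc n) k) i i ≡ shift (n C_) k
  diagonal = trans (∑-cong (subsetsOfSize (suc n) k) (λ p → 𝟙*𝟙 (lookup p i))) (#subsetsOfSize-∋ n k i)

cells : ∀ q → List (Fin q × Fin q)
cells q = pairs (allFin q) (allFin q)

cellPairs : ∀ q → List ((Fin q × Fin q) × (Fin q × Fin q))
cellPairs q = pairs (cells q) (cells q)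

module _ {q : ℕ} (S : Subset² q) where

  inS : Fin q × Fin q → ℕ
  inS (i , j) = 𝟙 (S i j)

  cellHit : Subset q × Subset q → Fin q × Fin q → ℕ
  cellHit (X , Y) (i , j) = 𝟙 (lookup X i) * 𝟙 (lookup Y j) * 𝟙 (S i j)

  hits : Subset q × Subset q → ℕ
  hits XY = ∑ (cells q) (cellHit XY)

  hits≡0 : ∀ XY → meets S XY ≢ true → hits XY ≡ 0
  hits≡0 (X , Y) ¬meets = trans (∑-pairs (allFin q) (allFin q) (cellHit (X , Y)))
    (∑≡0-if-¬any (allFin q) _ (λ i → ∑≡0-if-¬any (allFin q) _ (λ j → 𝟙-∧-≡0 (lookup X i) (lookup Y j) (S i j)))
      (¬-not ¬meets))

  ∑-hits : (LX LY : List (Subset q)) {cx cy : ℕ} →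
           (∀ i → ∑[ X ∈ LX ] 𝟙 (lookup X i) ≡ cx) → (∀ j → ∑[ Y ∈ LY ] 𝟙 (lookup Y j) ≡ cy) →
           ∑ (pairs LX LY) hits ≡ card² S * (cx * cy)
  ∑-hits LX LY {cx} {cy} coverX coverY = begin
    ∑ (pairs LX LY) hits                                        ≡⟨ ∑-pairs LX LY hits ⟩
    ∑[ X ∈ LX ] ∑[ Y ∈ LY ] ∑[ c ∈ cells q ] cellHit (X , Y) c  ≡⟨ ∑-cong LX (λ X → ∑-comm LY (cells q) _) ⟩
    ∑[ X ∈ LX ] ∑[ c ∈ cells q ] ∑[ Y ∈ LY ] cellHit (X , Y) c  ≡⟨ ∑-comm LX (cells q) _ ⟩
    ∑[ c ∈ cells q ] ∑[ X ∈ LX ] ∑[ Y ∈ LY ] cellHit (X , Y) c  ≡⟨ ∑-cong (cells q) per-cell ⟩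
    ∑[ c ∈ cells q ] (cx * cy * inS c)                          ≡⟨ ∑-distribˡ-* (cells q) (cx * cy) inS ⟩
    cx * cy * ∑ (cells q) inS                                   ≡⟨ cong (cx * cy *_) (∑-pairs (allFin q) (allFin q) inS) ⟩
    cx * cy * card² S                                           ≡⟨ *-comm (cx * cy) _ ⟩
    card² S * (cx * cy)                                         ∎
    where
    open ≡-Reasoning
    per-cell : ∀ c → ∑[ X ∈ LX ] ∑[ Y ∈ LY ] cellHit (X , Y) c ≡ cx * cy * inS c
    per-cell (i , j) = trans (∑∑-separate LX LY (λ X → 𝟙 (lookup X i)) (λ Y → 𝟙 (lookup Y j)) (𝟙 (S i j)))
                             (cong₂ (λ a b → a * b * 𝟙 (S i j)) (coverX i) (coverY j))

  weighted : (u v : Fin q → Fin q → ℕ) → (Fin q × Fin q) × (Fin q × Fin q) → ℕ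
  weighted u v ((i , j) , (k , l)) = u i k * v j l * (𝟙 (S i j) * 𝟙 (S k l))

  pairSum : (u v : Fin q → Fin q → ℕ) → ℕ
  pairSum u v = ∑ (cellPairs q) (weighted u v)

  ∑-hits² : (LX LY : List (Subset q)) →
            ∑[ XY ∈ pairs LX LY ] (hits XY * hits XY) ≡ pairSum (coverage LX) (coverage LY)
  ∑-hits² LX LY = begin
    ∑[ XY ∈ pairs LX LY ] (hits XY * hits XY)
      ≡⟨ ∑-cong (pairs LX LY) (λ XY → trans (∑-*-∑ (cells q) (cells q) (cellHit XY) (cellHit XY)) (sym (∑-pairs (cells q) (cells q) _))) ⟩
    ∑[ XY ∈ pairs LX LY ] ∑[ cc ∈ cellPairs q ] (cellHit XY (proj₁ cc) * cellHit XY (proj₂ cc))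
      ≡⟨ ∑-comm (pairs LX LY) (cellPairs q) _ ⟩
    ∑[ cc ∈ cellPairs q ] ∑[ XY ∈ pairs LX LY ] (cellHit XY (proj₁ cc) * cellHit XY (proj₂ cc))
      ≡⟨ ∑-cong (cellPairs q) per-pair ⟩
    pairSum (coverage LX) (coverage LY) ∎
    where
    open ≡-Reasoning
    regroup : ∀ a b c a′ b′ c′ → a * b * c * (a′ * b′ * c′) ≡ a * a′ * (b * b′) * (c * c′)
    regroup = solve-∀
    per-pair : ∀ cc → ∑[ XY ∈ pairs LX LY ] (cellHit XY (proj₁ cc) * cellHit XY (proj₂ cc))
                      ≡ weighted (coverage LX) (coverage LY) cc
    per-pair ((i , j) , (k , l)) = begin
      ∑[ XY ∈ pairs LX LY ] (cellHit XY (i , j) * cellHit XY (k , l))          ≡⟨ ∑-pairs LX LY _ ⟩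
      ∑[ X ∈ LX ] ∑[ Y ∈ LY ] (cellHit (X , Y) (i , j) * cellHit (X , Y) (k , l))
        ≡⟨ ∑-cong LX (λ X → ∑-cong LY (λ Y → regroup (𝟙 (lookup X i)) (𝟙 (lookup Y j)) _ (𝟙 (lookup X k)) _ _)) ⟩
      ∑[ X ∈ LX ] ∑[ Y ∈ LY ] (𝟙 (lookup X i) * 𝟙 (lookup X k) * (𝟙 (lookup Y j) * 𝟙 (lookup Y l)) * (𝟙 (S i j) * 𝟙 (S k l)))
        ≡⟨ ∑∑-separate LX LY _ _ _ ⟩
      weighted (coverage LX) (coverage LY) ((i , j) , (k , l))                ∎

  pairSum-mono-≤ : {u u′ v v′ : Fin q → Fin q → ℕ} → (∀ i k → u i k ≤ u′ i k) → (∀ j l → v j l ≤ v′ j l) →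
                   pairSum u v ≤ pairSum u′ v′
  pairSum-mono-≤ u≤u′ v≤v′ = ∑-mono-≤ (cellPairs q) λ where
    ((i , j) , (k , l)) → *-monoˡ-≤ (𝟙 (S i j) * 𝟙 (S k l)) (*-mono-≤ (u≤u′ i k) (v≤v′ j l))

  pairSum-scale : (u v : Fin q → Fin q → ℕ) (a b : ℕ) →
                  pairSum (λ i k → u i k * a) (λ j l → v j l * b) ≡ pairSum u v * (a * b)
  pairSum-scale u v a b = trans (∑-cong (cellPairs q) regroup′) (∑-distribʳ-* (cellPairs q) (a * b) (weighted u v))
    where
    regroup : ∀ x a y b z → x * a * (y * b) * z ≡ x * y * z * (a * b)
    regroup = solve-∀
    regroup′ : ∀ cc → weighted (λ i k → u i k * a) (λ j l → v j l * b) cc ≡ weighted u v cc * (a * b)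
    regroup′ ((i , j) , (k , l)) = regroup (u i k) a (v j l) b _

  pairSum-expand : (α β γ ε : ℕ) →
    pairSum (λ i k → δ i k * α + β) (λ j l → δ j l * γ + ε)
      ≡ α * γ * pairSum δ δ + α * ε * pairSum δ 𝟏 + β * γ * pairSum 𝟏 δ + β * ε * pairSum 𝟏 𝟏
  pairSum-expand α β γ ε =
    trans (∑-cong (cellPairs q) expand) (∑-lincomb (cellPairs q) (α * γ) (α * ε) (β * γ) (β * ε) (weighted δ δ) (weighted δ 𝟏) (weighted 𝟏 δ) (weighted 𝟏 𝟏))
    where
    expand-ℕ : ∀ d d′ α β γ ε x → (d * α + β) * (d′ * γ + ε) * x
               ≡ α * γ * (d * d′ * x) + α * ε * (d * 1 * x) + β * γ * (1 * d′ * x) + β * ε * (1 * 1 * x)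
    expand-ℕ = solve-∀
    expand : ∀ cc → weighted (λ i k → δ i k * α + β) (λ j l → δ j l * γ + ε) cc
                    ≡ α * γ * weighted δ δ cc + α * ε * weighted δ 𝟏 cc + β * γ * weighted 𝟏 δ cc + β * ε * weighted 𝟏 𝟏 cc
    expand ((i , j) , (k , l)) = expand-ℕ (δ i k) (δ j l) α β γ ε _

  private
    row col : Fin q → ℕ
    row i = ∑[ j ∈ allFin q ] 𝟙 (S i j)
    col j = ∑[ i ∈ allFin q ] 𝟙 (S i j)

    pairSum-unfold : (u v : Fin q → Fin q → ℕ) →
      pairSum u v ≡ ∑[ c ∈ cells q ] ∑[ k ∈ allFin q ] ∑[ l ∈ allFin q ] weighted u v (c , (k , l))
    pairSum-unfold u v =
      trans (∑-pairs (cells q) (cells q) (weighted u v)) (∑-cong (cells q) (λ c → ∑-pairs (allFin q) (allFin q) _))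

    ∑-cells : (f : Fin q → Fin q → ℕ) → ∑[ c ∈ cells q ] f (proj₁ c) (proj₂ c) ≡ ∑[ i ∈ allFin q ] ∑[ j ∈ allFin q ] f i j
    ∑-cells f = ∑-pairs (allFin q) (allFin q) _

  pairSum-δ-δ : pairSum δ δ ≡ card² S
  pairSum-δ-δ = trans (pairSum-unfold δ δ) (trans (∑-cong (cells q) same-cell) (∑-cells (λ i j → 𝟙 (S i j))))
    where
    same-cell : ∀ c → ∑[ k ∈ allFin q ] ∑[ l ∈ allFin q ] weighted δ δ (c , (k , l)) ≡ inS c
    same-cell (i , j) = begin
      ∑[ k ∈ allFin q ] ∑[ l ∈ allFin q ] (δ i k * δ j l * (𝟙 (S i j) * 𝟙 (S k l)))
        ≡⟨ ∑-cong (allFin q) (λ k → trans (∑-cong (allFin q) (λ l → *-assoc (δ i k) _ _)) (∑-distribˡ-* (allFin q) (δ i k) _)) ⟩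
      ∑[ k ∈ allFin q ] (δ i k * ∑[ l ∈ allFin q ] (δ j l * (𝟙 (S i j) * 𝟙 (S k l)))) ≡⟨ ∑-δ i _ ⟩
      ∑[ l ∈ allFin q ] (δ j l * (𝟙 (S i j) * 𝟙 (S i l)))                            ≡⟨ ∑-δ j _ ⟩
      𝟙 (S i j) * 𝟙 (S i j)                                                            ≡⟨ 𝟙*𝟙 (S i j) ⟩
      𝟙 (S i j)                                                                        ∎
      where open ≡-Reasoning

  pairSum-δ-𝟏 : pairSum δ 𝟏 ≡ Vx S
  pairSum-δ-𝟏 = begin
    pairSum δ 𝟏                                              ≡⟨ trans (pairSum-unfold δ 𝟏) (∑-cong (cells q) same-row) ⟩
    ∑[ c ∈ cells q ] (inS c * row (proj₁ c))                 ≡⟨ ∑-cells (λ i j → 𝟙 (S i j) * row i) ⟩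
    ∑[ i ∈ allFin q ] ∑[ j ∈ allFin q ] (𝟙 (S i j) * row i)  ≡⟨ ∑-cong (allFin q) (λ i → ∑-distribʳ-* (allFin q) (row i) _) ⟩
    Vx S                                                     ∎
    where
    open ≡-Reasoning
    same-row : ∀ c → ∑[ k ∈ allFin q ] ∑[ l ∈ allFin q ] weighted δ 𝟏 (c , (k , l)) ≡ inS c * row (proj₁ c)
    same-row (i , j) = begin
      ∑[ k ∈ allFin q ] ∑[ l ∈ allFin q ] (δ i k * 1 * (𝟙 (S i j) * 𝟙 (S k l)))
        ≡⟨ ∑-cong (allFin q) (λ k → trans (∑-cong (allFin q) (λ l → cong (_* _) (*-identityʳ (δ i k))))
                                          (∑-distribˡ-* (allFin q) (δ i k) _)) ⟩
      ∑[ k ∈ allFin q ] (δ i k * ∑[ l ∈ allFin q ] (𝟙 (S i j) * 𝟙 (S k l)))  ≡⟨ ∑-δ i _ ⟩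
      ∑[ l ∈ allFin q ] (𝟙 (S i j) * 𝟙 (S i l))                              ≡⟨ ∑-distribˡ-* (allFin q) (𝟙 (S i j)) _ ⟩
      𝟙 (S i j) * row i                                                        ∎

  pairSum-𝟏-δ : pairSum 𝟏 δ ≡ Vy S
  pairSum-𝟏-δ = begin
    pairSum 𝟏 δ                                              ≡⟨ trans (pairSum-unfold 𝟏 δ) (∑-cong (cells q) same-column) ⟩
    ∑[ c ∈ cells q ] (inS c * col (proj₂ c))                 ≡⟨ ∑-cells (λ i j → 𝟙 (S i j) * col j) ⟩
    ∑[ i ∈ allFin q ] ∑[ j ∈ allFin q ] (𝟙 (S i j) * col j)  ≡⟨ ∑-comm (allFin q) (allFin q) _ ⟩
    ∑[ j ∈ allFin q ] ∑[ i ∈ allFin q ] (𝟙 (S i j) * col j)  ≡⟨ ∑-cong (allFin q) (λ j → ∑-distribʳ-* (allFin q) (col j) _) ⟩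
    Vy S                                                     ∎
    where
    open ≡-Reasoning
    same-column : ∀ c → ∑[ k ∈ allFin q ] ∑[ l ∈ allFin q ] weighted 𝟏 δ (c , (k , l)) ≡ inS c * col (proj₂ c)
    same-column (i , j) = begin
      ∑[ k ∈ allFin q ] ∑[ l ∈ allFin q ] (1 * δ j l * (𝟙 (S i j) * 𝟙 (S k l)))
        ≡⟨ ∑-cong (allFin q) (λ k → trans (∑-cong (allFin q) (λ l → cong (_* _) (*-identityˡ (δ j l)))) (∑-δ j _)) ⟩
      ∑[ k ∈ allFin q ] (𝟙 (S i j) * 𝟙 (S k j))  ≡⟨ ∑-distribˡ-* (allFin q) (𝟙 (S i j)) _ ⟩
      𝟙 (S i j) * col j                          ∎

  pairSum-𝟏-𝟏 : pairSum 𝟏 𝟏 ≡ card² S * card² S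
  pairSum-𝟏-𝟏 = begin
    pairSum 𝟏 𝟏                                                ≡⟨ ∑-pairs (cells q) (cells q) (weighted 𝟏 𝟏) ⟩
    ∑[ c ∈ cells q ] ∑[ c′ ∈ cells q ] weighted 𝟏 𝟏 (c , c′)  ≡⟨ ∑-cong (cells q) (λ c → ∑-cong (cells q) (λ c′ → drop-weights c c′)) ⟩
    ∑[ c ∈ cells q ] ∑[ c′ ∈ cells q ] (inS c * inS c′)        ≡⟨ ∑-*-∑ (cells q) (cells q) inS inS ⟨
    ∑ (cells q) inS * ∑ (cells q) inS                          ≡⟨ cong (λ n → n * n) (∑-cells (λ i j → 𝟙 (S i j))) ⟩
    card² S * card² S                                          ∎
    where
    open ≡-Reasoning
    drop-weights : ∀ c c′ → weighted 𝟏 𝟏 (c , c′) ≡ inS c * inS c′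
    drop-weights (i , j) (k , l) = +-identityʳ _

  ∑-hits²-≤ : (LX LY : List (Subset q)) {A B α β γ ε : ℕ} →
    (∀ i k → coverage LX i k * A ≤ δ i k * α + β) → (∀ j l → coverage LY j l * B ≤ δ j l * γ + ε) →
    ∑[ XY ∈ pairs LX LY ] (hits XY * hits XY) * (A * B)
      ≤ α * γ * card² S + α * ε * Vx S + β * γ * Vy S + β * ε * (card² S * card² S)
  ∑-hits²-≤ LX LY {A} {B} {α} {β} {γ} {ε} boundX boundY = begin
    ∑[ XY ∈ pairs LX LY ] (hits XY * hits XY) * (A * B)            ≡⟨ cong (_* (A * B)) (∑-hits² LX LY) ⟩
    pairSum (coverage LX) (coverage LY) * (A * B)                  ≡⟨ pairSum-scale (coverage LX) (coverage LY) A B ⟨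
    pairSum (λ i k → coverage LX i k * A) (λ j l → coverage LY j l * B) ≤⟨ pairSum-mono-≤ boundX boundY ⟩
    pairSum (λ i k → δ i k * α + β) (λ j l → δ j l * γ + ε)       ≡⟨ pairSum-expand α β γ ε ⟩
    α * γ * pairSum δ δ + α * ε * pairSum δ 𝟏 + β * γ * pairSum 𝟏 δ + β * ε * pairSum 𝟏 𝟏
      ≡⟨ cong₂ _+_ (cong₂ _+_ (cong₂ _+_ (cong (α * γ *_) pairSum-δ-δ) (cong (α * ε *_) pairSum-δ-𝟏))
                              (cong (β * γ *_) pairSum-𝟏-δ)) (cong (β * ε *_) pairSum-𝟏-𝟏) ⟩
    α * γ * card² S + α * ε * Vx S + β * γ * Vy S + β * ε * (card² S * card² S) ∎
    where open ≤-Reasoning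

x^2≡x*x : ∀ x → x ^ 2 ≡ x * x
x^2≡x*x x = cong (x *_) (*-identityʳ x)

x^3≡x*[x*x] : ∀ x → x ^ 3 ≡ x * (x * x)
x^3≡x*[x*x] x = cong (λ y → x * (x * y)) (*-identityʳ x)

m*m≤n*n⇒m≤n : ∀ {m n} → m * m ≤ n * n → m ≤ n
m*m≤n*n⇒m≤n mm≤nn = ≮⇒≥ (λ n<m → <⇒≱ (*-mono-< n<m n<m) mm≤nn)

module _ {q n : ℕ} .{{_ : NonZero q}} where

  A*V≤n*n*A₁ : ∀ a A A₁ V → a * A ≡ q * A₁ → q * q ≤ a * a * n → V * V ≤ n * (n * n) → A * V ≤ n * n * A₁
  A*V≤n*n*A₁ a A A₁ V a*A≡q*A₁ q²≤a²n V²≤n³ = *-cancelˡ-≤ q (begin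
    q * (A * V)       ≡⟨ x∙yz≈y∙xz q A V ⟩
    A * (q * V)       ≤⟨ *-monoʳ-≤ A q*V≤a*n*n ⟩
    A * (a * (n * n)) ≡⟨ x∙yz≈yx∙z A a (n * n) ⟩
    a * A * (n * n)   ≡⟨ cong (_* (n * n)) a*A≡q*A₁ ⟩
    q * A₁ * (n * n)  ≡⟨ xy∙z≈x∙zy q A₁ (n * n) ⟩
    q * (n * n * A₁)  ∎)
    where
    open ≤-Reasoning
    a²n⁴≡[an²]² : ∀ a n → a * a * n * (n * (n * n)) ≡ a * (n * n) * (a * (n * n))
    a²n⁴≡[an²]² = solve-∀
    q*V≤a*n*n : q * V ≤ a * (n * n)
    q*V≤a*n*n = m*m≤n*n⇒m≤n (begin
      q * V * (q * V)             ≡⟨ *-interchange q V q V ⟩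
      q * q * (V * V)             ≤⟨ *-mono-≤ q²≤a²n V²≤n³ ⟩
      a * a * n * (n * (n * n))   ≡⟨ a²n⁴≡[an²]² a n ⟩
      a * (n * n) * (a * (n * n)) ∎)

  A*B≤n*[A₁*B₁] : ∀ a b A A₁ B B₁ → a * A ≡ q * A₁ → b * B ≡ q * B₁ →
                  q * q ≤ a * a * n → q * q ≤ b * b * n → A * B ≤ n * (A₁ * B₁)
  A*B≤n*[A₁*B₁] a b A A₁ B B₁ a*A≡q*A₁ b*B≡q*B₁ q²≤a²n q²≤b²n =
    *-cancelˡ-≤ (q * q) {{m*n≢0 q q}} (begin
    q * q * (A * B)             ≤⟨ *-monoˡ-≤ (A * B) q²≤n*a*b ⟩
    n * (a * b) * (A * B)       ≡⟨ regroup n a b A B ⟩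
    n * ((a * A) * (b * B))     ≡⟨ cong (n *_) (cong₂ _*_ a*A≡q*A₁ b*B≡q*B₁) ⟩
    n * ((q * A₁) * (q * B₁))   ≡⟨ regroup′ n q A₁ B₁ ⟩
    q * q * (n * (A₁ * B₁))     ∎)
    where
    open ≤-Reasoning
    regroup : ∀ n a b A B → n * (a * b) * (A * B) ≡ n * ((a * A) * (b * B))
    regroup = solve-∀
    regroup′ : ∀ n q A₁ B₁ → n * ((q * A₁) * (q * B₁)) ≡ q * q * (n * (A₁ * B₁))
    regroup′ = solve-∀
    square-product : ∀ a b n → a * a * n * (b * b * n) ≡ n * (a * b) * (n * (a * b))
    square-product = solve-∀
    q²≤n*a*b : q * q ≤ n * (a * b)
    q²≤n*a*b = m*m≤n*n⇒m≤n (≤-trans (*-mono-≤ q²≤a²n q²≤b²n) (≤-reflexive (square-product a b n)))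

  four-terms≤4*M² : ∀ a b A A₁ B B₁ Vx Vy → a * A ≡ q * A₁ → b * B ≡ q * B₁ →
    q ^ 2 ≤ a ^ 2 * n → q ^ 2 ≤ b ^ 2 * n → Vx ^ 2 ≤ n ^ 3 → Vy ^ 2 ≤ n ^ 3 →
    A * A₁ * (B * B₁) * n + A * A₁ * (B₁ * B₁) * Vx + A₁ * A₁ * (B * B₁) * Vy + A₁ * A₁ * (B₁ * B₁) * (n * n)
      ≤ 4 * (n * (A₁ * B₁) * (n * (A₁ * B₁)))
  four-terms≤4*M² a b A A₁ B B₁ Vx Vy a*A≡q*A₁ b*B≡q*B₁ q²≤a²n q²≤b²n Vx²≤n³ Vy²≤n³ = begin
    A * A₁ * (B * B₁) * n + A * A₁ * (B₁ * B₁) * Vx + A₁ * A₁ * (B * B₁) * Vy + A₁ * A₁ * (B₁ * B₁) * (n * n)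
      ≡⟨ regroup A A₁ B B₁ n Vx Vy ⟩
    A * B * (A₁ * B₁ * n) + A * Vx * (A₁ * (B₁ * B₁)) + B * Vy * (B₁ * (A₁ * A₁)) + A₁ * A₁ * (B₁ * B₁) * (n * n)
      ≤⟨ +-monoˡ-≤ _ (+-mono-≤ (+-mono-≤ (*-monoˡ-≤ _ (A*B≤n*[A₁*B₁] a b A A₁ B B₁ a*A≡q*A₁ b*B≡q*B₁ (square a q²≤a²n) (square b q²≤b²n)))
                                          (*-monoˡ-≤ _ (A*V≤n*n*A₁ a A A₁ Vx a*A≡q*A₁ (square a q²≤a²n) (cube Vx Vx²≤n³))))
                                (*-monoˡ-≤ _ (A*V≤n*n*A₁ b B B₁ Vy b*B≡q*B₁ (square b q²≤b²n) (cube Vy Vy²≤n³)))) ⟩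
    n * (A₁ * B₁) * (A₁ * B₁ * n) + n * n * A₁ * (A₁ * (B₁ * B₁)) + n * n * B₁ * (B₁ * (A₁ * A₁)) + A₁ * A₁ * (B₁ * B₁) * (n * n)
      ≡⟨ each-is-M² n A₁ B₁ ⟩
    4 * (n * (A₁ * B₁) * (n * (A₁ * B₁))) ∎
    where
    open ≤-Reasoning
    regroup : ∀ A A₁ B B₁ n Vx Vy →
      A * A₁ * (B * B₁) * n + A * A₁ * (B₁ * B₁) * Vx + A₁ * A₁ * (B * B₁) * Vy + A₁ * A₁ * (B₁ * B₁) * (n * n)
        ≡ A * B * (A₁ * B₁ * n) + A * Vx * (A₁ * (B₁ * B₁)) + B * Vy * (B₁ * (A₁ * A₁)) + A₁ * A₁ * (B₁ * B₁) * (n * n)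
    regroup = solve-∀
    each-is-M² : ∀ n A₁ B₁ →
      n * (A₁ * B₁) * (A₁ * B₁ * n) + n * n * A₁ * (A₁ * (B₁ * B₁)) + n * n * B₁ * (B₁ * (A₁ * A₁)) + A₁ * A₁ * (B₁ * B₁) * (n * n)
        ≡ 4 * (n * (A₁ * B₁) * (n * (A₁ * B₁)))
    each-is-M² = solve-∀
    square : ∀ a → q ^ 2 ≤ a ^ 2 * n → q * q ≤ a * a * n
    square a = subst₂ _≤_ (x^2≡x*x q) (cong (_* n) (x^2≡x*x a))
    cube : ∀ V → V ^ 2 ≤ n ^ 3 → V * V ≤ n * (n * n)
    cube V = subst₂ _≤_ (x^2≡x*x V) (x^3≡x*[x*x] n)

∑-hits-samplePairs : ∀ {q′} (S : Subset² (suc q′)) a′ b′ →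
  ∑ (samplePairs (suc q′) (suc a′) (suc b′)) (hits S) ≡ card² S * ((q′ C a′) * (q′ C b′))
∑-hits-samplePairs {q′} S a′ b′ =
  ∑-hits S (subsetsOfSize (suc q′) (suc a′)) (subsetsOfSize (suc q′) (suc b′)) (#subsetsOfSize-∋ q′ (suc a′)) (#subsetsOfSize-∋ q′ (suc b′))

∑-hits²-samplePairs-≤ : ∀ {q′} (S : Subset² (suc q′)) a′ b′ →
  Vx S ^ 2 ≤ card² S ^ 3 → Vy S ^ 2 ≤ card² S ^ 3 →
  suc q′ ^ 2 ≤ suc a′ ^ 2 * card² S → suc q′ ^ 2 ≤ suc b′ ^ 2 * card² S →
  ∑[ XY ∈ samplePairs (suc q′) (suc a′) (suc b′) ] (hits S XY * hits S XY) * length (samplePairs (suc q′) (suc a′) (suc b′))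
    ≤ 4 * (card² S * ((q′ C a′) * (q′ C b′)) * (card² S * ((q′ C a′) * (q′ C b′))))
∑-hits²-samplePairs-≤ {q′} S a′ b′ Vx²≤n³ Vy²≤n³ q²≤a²n q²≤b²n = begin
  Q * length (pairs LX LY)
    ≡⟨ cong (Q *_) (trans (length-pairs LX LY) (cong₂ _*_ (length-subsetsOfSize q a) (length-subsetsOfSize q b))) ⟩
  Q * ((q C a) * (q C b))
    ≤⟨ ∑-hits²-≤ S LX LY (coverage-subsetsOfSize-≤ q′ a) (coverage-subsetsOfSize-≤ q′ b) ⟩
  (q C a) * A₁ * ((q C b) * B₁) * n + (q C a) * A₁ * (B₁ * B₁) * Vx S
    + A₁ * A₁ * ((q C b) * B₁) * Vy S + A₁ * A₁ * (B₁ * B₁) * (n * n)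
    ≤⟨ four-terms≤4*M² {q} {n} a b (q C a) A₁ (q C b) B₁ (Vx S) (Vy S)
         (k*[1+n]Ck≡[1+n]*nC[k-1] q′ a) (k*[1+n]Ck≡[1+n]*nC[k-1] q′ b) q²≤a²n q²≤b²n Vx²≤n³ Vy²≤n³ ⟩
  4 * (n * (A₁ * B₁) * (n * (A₁ * B₁))) ∎
  where
  open ≤-Reasoning
  q = suc q′
  a = suc a′
  b = suc b′
  n = card² S
  A₁ = q′ C a′
  B₁ = q′ C b′
  LX = subsetsOfSize q a
  LY = subsetsOfSize q b
  Q = ∑[ XY ∈ pairs LX LY ] (hits S XY * hits S XY)

lemma3p6 : (q : ℕ) → 0 < q → (S : Subset² q) → 0 < card² S →
    Vx S ^ 2 ≤ card² S ^ 3 → Vy S ^ 2 ≤ card² S ^ 3 →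
    (a b : ℕ) → a ≤ q → b ≤ q →
    q ^ 2 ≤ a ^ 2 * card² S → q ^ 2 ≤ b ^ 2 * card² S →
    length (samplePairs q a b) ≤ 4 * goodPairs S a b
lemma3p6 (suc q′) _ S _ _ _ zero     b        _ _ () _
lemma3p6 (suc q′) _ S _ _ _ (suc a′) zero     _ _ _ ()
lemma3p6 q@(suc q′) _ S 0<n Vx²≤n³ Vy²≤n³ a@(suc a′) b@(suc b′) (s≤s a′≤q′) (s≤s b′≤q′) q²≤a²n q²≤b²n =
  second-moment-method (λ XY → meets S XY ≟ᴮ true) (samplePairs q a b) (hits S) 4 (hits≡0 S)
    (subst (0 <_) (sym E≡M) 0<M)
    (subst (λ E → Q ≤ 4 * (E * E)) (sym E≡M) (∑-hits²-samplePairs-≤ S a′ b′ Vx²≤n³ Vy²≤n³ q²≤a²n q²≤b²n))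
  where
  M = card² S * ((q′ C a′) * (q′ C b′))
  E≡M : ∑ (samplePairs q a b) (hits S) ≡ M
  E≡M = ∑-hits-samplePairs S a′ b′
  0<M : 0 < M
  0<M = *-mono-< 0<n (*-mono-< (k≤n⇒0<nCk a′≤q′) (k≤n⇒0<nCk b′≤q′))
  Q = ∑[ XY ∈ samplePairs q a b ] (hits S XY * hits S XY) * length (samplePairs q a b)
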